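{- Every msp-digraph has directed clique-width at most $7$.
   Context: A source is a vertex of indegree $0$, a sink a vertex of outdegree $0$. For vertex-disjoint digraphs $G_1=(V_1,E_1)$, $G_2=(V_2,E_2)$, let $O_1$ be the set of sinks of $G_1$ and $I_2$ the set of sources of $G_2$. The parallel composition is $G_1\cup G_2=(V_1\cup V_2,E_1\cup E_2)$; the series composition is $G_1\times G_2=(V_1\cup V_2,E_1\cup E_2\cup\{(v,w)\mid v\in O_1, w\in I_2\})$. Msp-digraphs: every single-vertex digraph is one, and if $G_1,G_2$ are vertex-disjoint msp-digraphs then $G_1\cup G_2$ and $G_1\times G_2$ are msp-digraphs. The directed clique-width of a digraph $G$ is the minimum number $k$ of labels needed to define $G$ using the operations: creation of a new vertex $v$ with label $a$; disjoint union of two labeled digraphs; $\alpha_{a,b}$ ($a\neq b$): insert an arc from every vertex with label $a$ to every vertex with label $b$; $\rho_{a\to b}$: change every label $a$ into label $b$. -}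

module Defs where

open import Data.Nat using (ℕ; zero; suc; _+_)
open import Data.Fin using (Fin; zero; suc; splitAt; _≟_)
open import Data.Bool using (Bool; true; false; _∧_; _∨_; not)
open import Data.Sum using (_⊎_; inj₁; inj₂)
open import Data.Product using (Σ; ∃; _,_)
open import Function.Bundles using (_↔_; Inverse)
open import Relation.Binary.PropositionalEquality using (_≡_; _≢_)
open import Relation.Nullary.Decidable using (⌊_⌋)

record Digraph : Set where
  constructor digraph
  field
    size : ℕ
    arc  : Fin size → Fin size → Bool
open Digraph public

_≅_ : Digraph → Digraph → Set
G ≅ H = Σ (Fin (size G) ↔ Fin (size H)) λ f →
          ∀ u v → arc G u v ≡ arc H (Inverse.to f u) (Inverse.to f v)

allFin : (n : ℕ) → (Fin n → Bool) → Bool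
allFin zero    p = true
allFin (suc n) p = p zero ∧ allFin n (λ i → p (suc i))

isSink : (G : Digraph) → Fin (size G) → Bool
isSink G v = allFin (size G) (λ w → not (arc G v w))

isSource : (G : Digraph) → Fin (size G) → Bool
isSource G v = allFin (size G) (λ w → not (arc G w v))

-- Disjoint union of vertex sets is modelled by Fin (m + n) (first m vertices
-- come from G₁, the remaining n from G₂).

parallel : Digraph → Digraph → Digraph
parallel G₁ G₂ = digraph (size G₁ + size G₂) E
  where
  E : Fin (size G₁ + size G₂) → Fin (size G₁ + size G₂) → Bool
  E u v with splitAt (size G₁) u | splitAt (size G₁) v
  ... | inj₁ a | inj₁ b = arc G₁ a b
  ... | inj₂ a | inj₂ b = arc G₂ a b
  ... | inj₁ a | inj₂ b = false
  ... | inj₂ a | inj₁ b = false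

series : Digraph → Digraph → Digraph
series G₁ G₂ = digraph (size G₁ + size G₂) E
  where
  E : Fin (size G₁ + size G₂) → Fin (size G₁ + size G₂) → Bool
  E u v with splitAt (size G₁) u | splitAt (size G₁) v
  ... | inj₁ a | inj₁ b = arc G₁ a b
  ... | inj₂ a | inj₂ b = arc G₂ a b
  ... | inj₁ a | inj₂ b = isSink G₁ a ∧ isSource G₂ b
  ... | inj₂ a | inj₁ b = false

single : Digraph
single = digraph 1 (λ _ _ → false)

-- Msp-digraphs: the inductive class, closed under isomorphism
-- (since vertex-disjoint copies / arbitrary vertex names are allowed).
data MSPTerm : Set where
  vtx : MSPTerm
  _∪ₘ_ : MSPTerm → MSPTerm → MSPTerm
  _×ₘ_ : MSPTerm → MSPTerm → MSPTerm

⟦_⟧ₘ : MSPTerm → Digraph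
⟦ vtx ⟧ₘ    = single
⟦ s ∪ₘ t ⟧ₘ = parallel ⟦ s ⟧ₘ ⟦ t ⟧ₘ
⟦ s ×ₘ t ⟧ₘ = series ⟦ s ⟧ₘ ⟦ t ⟧ₘ

IsMSP : Digraph → Set
IsMSP G = ∃ λ t → G ≅ ⟦ t ⟧ₘ

data DCWExpr (k : ℕ) : ℕ → Set where
  new    : Fin k → DCWExpr k 1
  _⊕_    : ∀ {m n} → DCWExpr k m → DCWExpr k n → DCWExpr k (m + n)
  α      : ∀ {n} (a b : Fin k) → a ≢ b → DCWExpr k n → DCWExpr k n
  ρ      : ∀ {n} (a b : Fin k) → DCWExpr k n → DCWExpr k n

label : ∀ {k n} → DCWExpr k n → Fin n → Fin k
label (new a)       _ = a
label (_⊕_ {m} e f) u with splitAt m u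
... | inj₁ x = label e x
... | inj₂ y = label f y
label (α a b _ e)   u = label e u
label (ρ a b e)     u with ⌊ label e u ≟ a ⌋
... | true  = b
... | false = label e u

arcs : ∀ {k n} → DCWExpr k n → Fin n → Fin n → Bool
arcs (new a)       _ _ = false
arcs (_⊕_ {m} e f) u v with splitAt m u | splitAt m v
... | inj₁ x | inj₁ y = arcs e x y
... | inj₂ x | inj₂ y = arcs f x y
... | inj₁ x | inj₂ y = false
... | inj₂ x | inj₁ y = false
arcs (α a b _ e)   u v = arcs e u v ∨ (⌊ label e u ≟ a ⌋ ∧ ⌊ label e v ≟ b ⌋)
arcs (ρ a b e)     u v = arcs e u v

⟦_⟧ : ∀ {k n} → DCWExpr k n → Digraph
⟦_⟧ {n = n} e = digraph n (arcs e)

dcw≤ : Digraph → ℕ → Set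
dcw≤ G k = Σ ℕ λ n → Σ (DCWExpr k n) λ e → G ≅ ⟦ e ⟧

{-# OPTIONS --safe #-}
-- Label every vertex by whether it is a source and whether it is a sink (labels 0–3).
-- A parallel composition is a disjoint union. For G × H, move the labels of H to 4–6,
-- add all arcs from the sink labels {2, 3} to the shifted source labels {4, 6}, and
-- relabel back into 0–3: vertices of G stop being sinks because H has a source,
-- vertices of H stop being sources because G has a sink, and nothing else changes.
module Submission where

open import Defs
open import Data.Nat using (zero; suc; _+_)
open import Data.Fin using (Fin; zero; suc; #_; splitAt; join; _↑ˡ_; _↑ʳ_; _≟_)
open import Data.Fin.Properties using (splitAt-↑ˡ; splitAt-↑ʳ; join-splitAt; all?)
open import Data.Bool using (Bool; true; false; _∧_; _∨_; not; if_then_else_)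
open import Data.Bool.Properties using (∧-identityʳ; ∧-zeroʳ; ∨-identityʳ; ∧-assoc)
  renaming (_≟_ to _≟ᴮ_)
open import Data.List using (List; []; _∷_)
open import Data.Sum using (_⊎_; inj₁; inj₂)
open import Data.Product using (∃; _×_; _,_; proj₁; proj₂)
open import Function.Bundles using (Inverse)
open import Relation.Binary.PropositionalEquality
open import Relation.Nullary.Decidable using (⌊_⌋; toWitness)
open ≡-Reasoning

↑-elim : ∀ {m n} (P : Fin (m + n) → Set) →
         (∀ a → P (a ↑ˡ n)) → (∀ b → P (m ↑ʳ b)) → ∀ u → P u
↑-elim {m} {n} P left right u = subst P (join-splitAt m n u) (by-cases (splitAt m u))
  where
  by-cases : ∀ s → P (join m n s)
  by-cases (inj₁ a) = left a
  by-cases (inj₂ b) = right b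

allFin-cong : ∀ n {p q : Fin n → Bool} → (∀ i → p i ≡ q i) → allFin n p ≡ allFin n q
allFin-cong zero    p≗q = refl
allFin-cong (suc n) p≗q = cong₂ _∧_ (p≗q zero) (allFin-cong n (λ i → p≗q (suc i)))

allFin-+ : ∀ m n (p : Fin (m + n) → Bool) →
           allFin (m + n) p ≡ allFin m (λ a → p (a ↑ˡ n)) ∧ allFin n (λ b → p (m ↑ʳ b))
allFin-+ zero    n p = refl
allFin-+ (suc m) n p = begin
  p zero ∧ allFin (m + n) (λ i → p (suc i))
    ≡⟨ cong (p zero ∧_) (allFin-+ m n (λ i → p (suc i))) ⟩
  p zero ∧ (allFin m (λ a → p (suc (a ↑ˡ n))) ∧ allFin n (λ b → p (suc (m ↑ʳ b))))
    ≡⟨ ∧-assoc (p zero) _ _ ⟨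
  (p zero ∧ allFin m (λ a → p (suc (a ↑ˡ n)))) ∧ allFin n (λ b → p (suc (m ↑ʳ b))) ∎

allFin-true : ∀ n → allFin n (λ _ → true) ≡ true
allFin-true zero    = refl
allFin-true (suc n) = allFin-true n

allFin-not-witness : ∀ n (p : Fin n → Bool) i → p i ≡ true → allFin n (λ j → not (p j)) ≡ false
allFin-not-witness (suc n) p zero    pi≡true rewrite pi≡true = refl
allFin-not-witness (suc n) p (suc i) pi≡true =
  trans (cong (not (p zero) ∧_) (allFin-not-witness n (λ j → p (suc j)) i pi≡true)) (∧-zeroʳ _)

HasSource HasSink : Digraph → Set
HasSource G = ∃ λ v → isSource G v ≡ true
HasSink   G = ∃ λ v → isSink G v ≡ true

isSource-cong : ∀ {n} {E E' : Fin n → Fin n → Bool} → (∀ u v → E u v ≡ E' u v) →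
                ∀ v → isSource (digraph n E) v ≡ isSource (digraph n E') v
isSource-cong {n} E≗E' v = allFin-cong n (λ w → cong not (E≗E' w v))

isSink-cong : ∀ {n} {E E' : Fin n → Fin n → Bool} → (∀ u v → E u v ≡ E' u v) →
              ∀ v → isSink (digraph n E) v ≡ isSink (digraph n E') v
isSink-cong {n} E≗E' v = allFin-cong n (λ w → cong not (E≗E' v w))

glue : (G H : Digraph) → (Fin (size G) → Fin (size H) → Bool) → Digraph
glue G H X = digraph (size G + size H) (λ u v → glued (splitAt (size G) u) (splitAt (size G) v))
  where
  glued : Fin (size G) ⊎ Fin (size H) → Fin (size G) ⊎ Fin (size H) → Bool
  glued (inj₁ a) (inj₁ b) = arc G a b
  glued (inj₁ a) (inj₂ b) = X a b
  glued (inj₂ a) (inj₁ b) = false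
  glued (inj₂ a) (inj₂ b) = arc H a b

module _ (G H : Digraph) (X : Fin (size G) → Fin (size H) → Bool) where
  private
    m = size G
    n = size H

  glue-arc-↑ˡ-↑ˡ : ∀ a b → arc (glue G H X) (a ↑ˡ n) (b ↑ˡ n) ≡ arc G a b
  glue-arc-↑ˡ-↑ˡ a b rewrite splitAt-↑ˡ m a n | splitAt-↑ˡ m b n = refl

  glue-arc-↑ˡ-↑ʳ : ∀ a b → arc (glue G H X) (a ↑ˡ n) (m ↑ʳ b) ≡ X a b
  glue-arc-↑ˡ-↑ʳ a b rewrite splitAt-↑ˡ m a n | splitAt-↑ʳ m n b = refl

  glue-arc-↑ʳ-↑ˡ : ∀ a b → arc (glue G H X) (m ↑ʳ a) (b ↑ˡ n) ≡ false
  glue-arc-↑ʳ-↑ˡ a b rewrite splitAt-↑ʳ m n a | splitAt-↑ˡ m b n = refl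

  glue-arc-↑ʳ-↑ʳ : ∀ a b → arc (glue G H X) (m ↑ʳ a) (m ↑ʳ b) ≡ arc H a b
  glue-arc-↑ʳ-↑ʳ a b rewrite splitAt-↑ʳ m n a | splitAt-↑ʳ m n b = refl

  isSource-glue-↑ˡ : ∀ a → isSource (glue G H X) (a ↑ˡ n) ≡ isSource G a
  isSource-glue-↑ˡ a = begin
    isSource (glue G H X) (a ↑ˡ n)
      ≡⟨ allFin-+ m n _ ⟩
    allFin m (λ w → not (arc (glue G H X) (w ↑ˡ n) (a ↑ˡ n))) ∧
      allFin n (λ w → not (arc (glue G H X) (m ↑ʳ w) (a ↑ˡ n)))
      ≡⟨ cong₂ _∧_ (allFin-cong m (λ w → cong not (glue-arc-↑ˡ-↑ˡ w a)))
                   (allFin-cong n (λ w → cong not (glue-arc-↑ʳ-↑ˡ w a))) ⟩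
    isSource G a ∧ allFin n (λ _ → true)
      ≡⟨ cong (isSource G a ∧_) (allFin-true n) ⟩
    isSource G a ∧ true
      ≡⟨ ∧-identityʳ _ ⟩
    isSource G a ∎

  isSource-glue-↑ʳ : ∀ b →
    isSource (glue G H X) (m ↑ʳ b) ≡ allFin m (λ a → not (X a b)) ∧ isSource H b
  isSource-glue-↑ʳ b = trans (allFin-+ m n _)
    (cong₂ _∧_ (allFin-cong m (λ w → cong not (glue-arc-↑ˡ-↑ʳ w b)))
               (allFin-cong n (λ w → cong not (glue-arc-↑ʳ-↑ʳ w b))))

  isSink-glue-↑ˡ : ∀ a →
    isSink (glue G H X) (a ↑ˡ n) ≡ isSink G a ∧ allFin n (λ b → not (X a b))
  isSink-glue-↑ˡ a = trans (allFin-+ m n _)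
    (cong₂ _∧_ (allFin-cong m (λ w → cong not (glue-arc-↑ˡ-↑ˡ a w)))
               (allFin-cong n (λ w → cong not (glue-arc-↑ˡ-↑ʳ a w))))

  isSink-glue-↑ʳ : ∀ b → isSink (glue G H X) (m ↑ʳ b) ≡ isSink H b
  isSink-glue-↑ʳ b = trans (allFin-+ m n _)
    (cong₂ _∧_ (trans (allFin-cong m (λ w → cong not (glue-arc-↑ʳ-↑ˡ b w))) (allFin-true m))
               (allFin-cong n (λ w → cong not (glue-arc-↑ʳ-↑ʳ b w))))

parallel-arc : ∀ G H u v → arc (parallel G H) u v ≡ arc (glue G H (λ _ _ → false)) u v
parallel-arc G H u v with splitAt (size G) u | splitAt (size G) v
... | inj₁ a | inj₁ b = refl
... | inj₁ a | inj₂ b = refl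
... | inj₂ a | inj₁ b = refl
... | inj₂ a | inj₂ b = refl

series-arc : ∀ G H u v →
             arc (series G H) u v ≡ arc (glue G H (λ a b → isSink G a ∧ isSource H b)) u v
series-arc G H u v with splitAt (size G) u | splitAt (size G) v
... | inj₁ a | inj₁ b = refl
... | inj₁ a | inj₂ b = refl
... | inj₂ a | inj₁ b = refl
... | inj₂ a | inj₂ b = refl

module _ (G H : Digraph) where
  private
    m = size G
    n = size H

  parallel-isSource-↑ˡ : ∀ a → isSource (parallel G H) (a ↑ˡ n) ≡ isSource G a
  parallel-isSource-↑ˡ a =
    trans (isSource-cong (parallel-arc G H) _) (isSource-glue-↑ˡ G H _ a)

  parallel-isSource-↑ʳ : ∀ b → isSource (parallel G H) (m ↑ʳ b) ≡ isSource H b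
  parallel-isSource-↑ʳ b = begin
    isSource (parallel G H) (m ↑ʳ b)       ≡⟨ isSource-cong (parallel-arc G H) _ ⟩
    isSource (glue G H _) (m ↑ʳ b)         ≡⟨ isSource-glue-↑ʳ G H _ b ⟩
    allFin m (λ _ → true) ∧ isSource H b  ≡⟨ cong (_∧ isSource H b) (allFin-true m) ⟩
    isSource H b                           ∎

  parallel-isSink-↑ˡ : ∀ a → isSink (parallel G H) (a ↑ˡ n) ≡ isSink G a
  parallel-isSink-↑ˡ a = begin
    isSink (parallel G H) (a ↑ˡ n)       ≡⟨ isSink-cong (parallel-arc G H) _ ⟩
    isSink (glue G H _) (a ↑ˡ n)         ≡⟨ isSink-glue-↑ˡ G H _ a ⟩
    isSink G a ∧ allFin n (λ _ → true)  ≡⟨ cong (isSink G a ∧_) (allFin-true n) ⟩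
    isSink G a ∧ true                    ≡⟨ ∧-identityʳ _ ⟩
    isSink G a                           ∎

  parallel-isSink-↑ʳ : ∀ b → isSink (parallel G H) (m ↑ʳ b) ≡ isSink H b
  parallel-isSink-↑ʳ b =
    trans (isSink-cong (parallel-arc G H) _) (isSink-glue-↑ʳ G H _ b)

  series-isSource-↑ˡ : ∀ a → isSource (series G H) (a ↑ˡ n) ≡ isSource G a
  series-isSource-↑ˡ a =
    trans (isSource-cong (series-arc G H) _) (isSource-glue-↑ˡ G H _ a)

  series-isSink-↑ʳ : ∀ b → isSink (series G H) (m ↑ʳ b) ≡ isSink H b
  series-isSink-↑ʳ b =
    trans (isSink-cong (series-arc G H) _) (isSink-glue-↑ʳ G H _ b)

  series-isSink-↑ˡ : HasSource H → ∀ a → isSink (series G H) (a ↑ˡ n) ≡ false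
  series-isSink-↑ˡ (b , source) a =
    trans (isSink-cong (series-arc G H) _)
          (trans (isSink-glue-↑ˡ G H _ a) (linked (isSink G a)))
    where
    linked : ∀ q → q ∧ allFin n (λ b → not (q ∧ isSource H b)) ≡ false
    linked false = refl
    linked true  = allFin-not-witness n (isSource H) b source

  series-isSource-↑ʳ : HasSink G → ∀ b → isSource (series G H) (m ↑ʳ b) ≡ false
  series-isSource-↑ʳ (a , sink) b =
    trans (isSource-cong (series-arc G H) _)
          (trans (isSource-glue-↑ʳ G H _ b) (linked (isSource H b)))
    where
    linked : ∀ p → allFin m (λ a → not (isSink G a ∧ p)) ∧ p ≡ false
    linked false = ∧-zeroʳ _
    linked true  = cong (_∧ true)
      (allFin-not-witness m (λ a → isSink G a ∧ true) a (trans (∧-identityʳ _) sink))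

msp-hasSource : ∀ t → HasSource ⟦ t ⟧ₘ
msp-hasSource vtx = zero , refl
msp-hasSource (s ∪ₘ t) with msp-hasSource s
... | a , source = a ↑ˡ _ , trans (parallel-isSource-↑ˡ ⟦ s ⟧ₘ ⟦ t ⟧ₘ a) source
msp-hasSource (s ×ₘ t) with msp-hasSource s
... | a , source = a ↑ˡ _ , trans (series-isSource-↑ˡ ⟦ s ⟧ₘ ⟦ t ⟧ₘ a) source

msp-hasSink : ∀ t → HasSink ⟦ t ⟧ₘ
msp-hasSink vtx = zero , refl
msp-hasSink (s ∪ₘ t) with msp-hasSink t
... | b , sink = _ ↑ʳ b , trans (parallel-isSink-↑ʳ ⟦ s ⟧ₘ ⟦ t ⟧ₘ b) sink
msp-hasSink (s ×ₘ t) with msp-hasSink t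
... | b , sink = _ ↑ʳ b , trans (series-isSink-↑ʳ ⟦ s ⟧ₘ ⟦ t ⟧ₘ b) sink

label-⊕-↑ˡ : ∀ {k m n} (e : DCWExpr k m) (f : DCWExpr k n) a →
             label (e ⊕ f) (a ↑ˡ n) ≡ label e a
label-⊕-↑ˡ {m = m} {n} e f a rewrite splitAt-↑ˡ m a n = refl

label-⊕-↑ʳ : ∀ {k m n} (e : DCWExpr k m) (f : DCWExpr k n) b →
             label (e ⊕ f) (m ↑ʳ b) ≡ label f b
label-⊕-↑ʳ {m = m} {n} e f b rewrite splitAt-↑ʳ m n b = refl

rename : ∀ {k} → Fin k → Fin k → Fin k → Fin k
rename a b x = if ⌊ x ≟ a ⌋ then b else x

label-ρ : ∀ {k n} a b (e : DCWExpr k n) u → label (ρ a b e) u ≡ rename a b (label e u)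
label-ρ a b e u with ⌊ label e u ≟ a ⌋
... | true  = refl
... | false = refl

ρ* : ∀ {k n} → List (Fin k × Fin k) → DCWExpr k n → DCWExpr k n
ρ* []             e = e
ρ* ((a , b) ∷ rs) e = ρ* rs (ρ a b e)

rename* : ∀ {k} → List (Fin k × Fin k) → Fin k → Fin k
rename* []             x = x
rename* ((a , b) ∷ rs) x = rename* rs (rename a b x)

label-ρ* : ∀ {k n} rs (e : DCWExpr k n) u → label (ρ* rs e) u ≡ rename* rs (label e u)
label-ρ* []             e u = refl
label-ρ* ((a , b) ∷ rs) e u = trans (label-ρ* rs (ρ a b e) u) (cong (rename* rs) (label-ρ a b e u))

status : Bool → Bool → Fin 7
status false false = # 0
status true  false = # 1
status false true  = # 2
status true  true  = # 3

shifting settling : List (Fin 7 × Fin 7)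
shifting = (# 1 , # 4) ∷ (# 2 , # 5) ∷ (# 3 , # 6) ∷ []
settling = (# 2 , # 0) ∷ (# 3 , # 1) ∷ (# 4 , # 0) ∷ (# 5 , # 2) ∷ (# 6 , # 2) ∷ []

marksSink marksShiftedSource : Fin 7 → Bool
marksSink          x = ⌊ x ≟ # 2 ⌋ ∨ ⌊ x ≟ # 3 ⌋
marksShiftedSource x = ⌊ x ≟ # 4 ⌋ ∨ ⌊ x ≟ # 6 ⌋

link : ∀ {n} → DCWExpr 7 n → DCWExpr 7 n
link e = α (# 3) (# 6) (λ ()) (α (# 3) (# 4) (λ ())
        (α (# 2) (# 6) (λ ()) (α (# 2) (# 4) (λ ()) e)))

-- Decided by evaluating all 49 label pairs; arcs-link transfers it to every expression,
-- because the arcs added by link depend only on the labels of their endpoints.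
link-new-⊕-new : ∀ x y →
                 arcs (link (new x ⊕ new y)) zero (suc zero) ≡ marksSink x ∧ marksShiftedSource y
link-new-⊕-new = toWitness {a? = all? λ x → all? λ y →
  arcs (link (new x ⊕ new y)) zero (suc zero) ≟ᴮ (marksSink x ∧ marksShiftedSource y)} _

arcs-link : ∀ {n} (e : DCWExpr 7 n) u v →
            arcs (link e) u v ≡ arcs e u v ∨ (marksSink (label e u) ∧ marksShiftedSource (label e v))
arcs-link e u v with arcs e u v
... | true  = refl
... | false = link-new-⊕-new (label e u) (label e v)

status-marks : ∀ p q → marksSink (status p q) ≡ q × marksShiftedSource (status p q) ≡ false
status-marks false false = refl , refl
status-marks true  false = refl , refl
status-marks false true  = refl , refl
status-marks true  true  = refl , refl

shifted-status-marks : ∀ p q → marksSink (rename* shifting (status p q)) ≡ false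
                             × marksShiftedSource (rename* shifting (status p q)) ≡ p
shifted-status-marks false false = refl , refl
shifted-status-marks true  false = refl , refl
shifted-status-marks false true  = refl , refl
shifted-status-marks true  true  = refl , refl

settled-status : ∀ p q → rename* settling (status p q) ≡ status p false
settled-status false false = refl
settled-status true  false = refl
settled-status false true  = refl
settled-status true  true  = refl

settled-shifted-status : ∀ p q → rename* settling (rename* shifting (status p q)) ≡ status false q
settled-shifted-status false false = refl
settled-shifted-status true  false = refl
settled-shifted-status false true  = refl
settled-shifted-status true  true  = refl

statusOf : (G : Digraph) → Fin (size G) → Fin 7
statusOf G u = status (isSource G u) (isSink G u)

record Encodes (G : Digraph) (e : DCWExpr 7 (size G)) : Set where
  field
    arcs≡  : ∀ u v → arcs e u v ≡ arc G u v
    label≡ : ∀ u → label e u ≡ statusOf G u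
open Encodes

_⊛_ : ∀ {m n} → DCWExpr 7 m → DCWExpr 7 n → DCWExpr 7 (m + n)
e ⊛ f = ρ* settling (link (e ⊕ ρ* shifting f))

module _ {G H : Digraph} {e : DCWExpr 7 (size G)} {f : DCWExpr 7 (size H)}
         (eG : Encodes G e) (fH : Encodes H f) where
  private
    m = size G
    n = size H
    E = e ⊕ ρ* shifting f

  ⊕-encodes-parallel : Encodes (parallel G H) (e ⊕ f)
  ⊕-encodes-parallel .arcs≡ u v with splitAt m u | splitAt m v
  ... | inj₁ a | inj₁ b = arcs≡ eG a b
  ... | inj₁ a | inj₂ b = refl
  ... | inj₂ a | inj₁ b = refl
  ... | inj₂ a | inj₂ b = arcs≡ fH a b
  ⊕-encodes-parallel .label≡ = ↑-elim _ left right
    where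
    left : ∀ a → label (e ⊕ f) (a ↑ˡ n) ≡ statusOf (parallel G H) (a ↑ˡ n)
    left a = begin
      label (e ⊕ f) (a ↑ˡ n)                 ≡⟨ label-⊕-↑ˡ e f a ⟩
      label e a                              ≡⟨ label≡ eG a ⟩
      status (isSource G a) (isSink G a)     ≡⟨ cong₂ status (parallel-isSource-↑ˡ G H a)
                                                            (parallel-isSink-↑ˡ G H a) ⟨
      statusOf (parallel G H) (a ↑ˡ n)       ∎
    right : ∀ b → label (e ⊕ f) (m ↑ʳ b) ≡ statusOf (parallel G H) (m ↑ʳ b)
    right b = begin
      label (e ⊕ f) (m ↑ʳ b)                 ≡⟨ label-⊕-↑ʳ e f b ⟩
      label f b                              ≡⟨ label≡ fH b ⟩
      status (isSource H b) (isSink H b)     ≡⟨ cong₂ status (parallel-isSource-↑ʳ G H b)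
                                                            (parallel-isSink-↑ʳ G H b) ⟨
      statusOf (parallel G H) (m ↑ʳ b)       ∎

  label-shifted : ∀ b → label (ρ* shifting f) b ≡ rename* shifting (statusOf H b)
  label-shifted b = trans (label-ρ* shifting f b) (cong (rename* shifting) (label≡ fH b))

  marksSink-label : ∀ a → marksSink (label e a) ≡ isSink G a
  marksSink-label a =
    trans (cong marksSink (label≡ eG a)) (proj₁ (status-marks (isSource G a) (isSink G a)))

  marksShiftedSource-label : ∀ a → marksShiftedSource (label e a) ≡ false
  marksShiftedSource-label a =
    trans (cong marksShiftedSource (label≡ eG a)) (proj₂ (status-marks (isSource G a) (isSink G a)))

  marksSink-shifted-label : ∀ b → marksSink (label (ρ* shifting f) b) ≡ false
  marksSink-shifted-label b = trans (cong marksSink (label-shifted b))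
    (proj₁ (shifted-status-marks (isSource H b) (isSink H b)))

  marksShiftedSource-shifted-label : ∀ b →
    marksShiftedSource (label (ρ* shifting f) b) ≡ isSource H b
  marksShiftedSource-shifted-label b = trans (cong marksShiftedSource (label-shifted b))
    (proj₂ (shifted-status-marks (isSource H b) (isSink H b)))

  ⊛-arcs : ∀ u v → arcs (e ⊛ f) u v ≡ arc (series G H) u v
  ⊛-arcs u v = trans (arcs-link E u v) (quadrants u v)
    where
    quadrants : ∀ u v → arcs E u v ∨ (marksSink (label E u) ∧ marksShiftedSource (label E v))
                      ≡ arc (series G H) u v
    quadrants u v with splitAt m u | splitAt m v
    ... | inj₁ a | inj₁ b = begin
      arcs e a b ∨ (marksSink (label e a) ∧ marksShiftedSource (label e b))
        ≡⟨ cong₂ (λ r s → r ∨ (marksSink (label e a) ∧ s))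
                 (arcs≡ eG a b) (marksShiftedSource-label b) ⟩
      arc G a b ∨ (marksSink (label e a) ∧ false)
        ≡⟨ cong (arc G a b ∨_) (∧-zeroʳ _) ⟩
      arc G a b ∨ false
        ≡⟨ ∨-identityʳ _ ⟩
      arc G a b ∎
    ... | inj₁ a | inj₂ b =
      cong₂ _∧_ (marksSink-label a) (marksShiftedSource-shifted-label b)
    ... | inj₂ a | inj₁ b = cong (_∧ _) (marksSink-shifted-label a)
    ... | inj₂ a | inj₂ b = trans (cong₂ (λ r s → r ∨ (s ∧ _)) (arcs≡ fH a b)
                                         (marksSink-shifted-label a))
                                  (∨-identityʳ _)

  ⊛-labels : HasSink G → HasSource H → ∀ u → label (e ⊛ f) u ≡ statusOf (series G H) u
  ⊛-labels sink source = ↑-elim _ left right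
    where
    left : ∀ a → label (e ⊛ f) (a ↑ˡ n) ≡ statusOf (series G H) (a ↑ˡ n)
    left a = begin
      label (e ⊛ f) (a ↑ˡ n)
        ≡⟨ label-ρ* settling (link E) (a ↑ˡ n) ⟩
      rename* settling (label E (a ↑ˡ n))
        ≡⟨ cong (rename* settling) (trans (label-⊕-↑ˡ e _ a) (label≡ eG a)) ⟩
      rename* settling (statusOf G a)
        ≡⟨ settled-status (isSource G a) (isSink G a) ⟩
      status (isSource G a) false
        ≡⟨ cong₂ status (series-isSource-↑ˡ G H a) (series-isSink-↑ˡ G H source a) ⟨
      statusOf (series G H) (a ↑ˡ n) ∎
    right : ∀ b → label (e ⊛ f) (m ↑ʳ b) ≡ statusOf (series G H) (m ↑ʳ b)
    right b = begin
      label (e ⊛ f) (m ↑ʳ b)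
        ≡⟨ label-ρ* settling (link E) (m ↑ʳ b) ⟩
      rename* settling (label E (m ↑ʳ b))
        ≡⟨ cong (rename* settling) (trans (label-⊕-↑ʳ e _ b) (label-shifted b)) ⟩
      rename* settling (rename* shifting (statusOf H b))
        ≡⟨ settled-shifted-status (isSource H b) (isSink H b) ⟩
      status false (isSink H b)
        ≡⟨ cong₂ status (series-isSource-↑ʳ G H sink b) (series-isSink-↑ʳ G H b) ⟨
      statusOf (series G H) (m ↑ʳ b) ∎

  ⊛-encodes-series : HasSink G → HasSource H → Encodes (series G H) (e ⊛ f)
  ⊛-encodes-series sink source = record { arcs≡ = ⊛-arcs ; label≡ = ⊛-labels sink source }

mspExpr : (t : MSPTerm) → DCWExpr 7 (size ⟦ t ⟧ₘ)
mspExpr vtx      = new (status true true)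
mspExpr (s ∪ₘ t) = mspExpr s ⊕ mspExpr t
mspExpr (s ×ₘ t) = mspExpr s ⊛ mspExpr t

mspExpr-encodes : ∀ t → Encodes ⟦ t ⟧ₘ (mspExpr t)
mspExpr-encodes vtx .arcs≡ zero zero = refl
mspExpr-encodes vtx .label≡ zero     = refl
mspExpr-encodes (s ∪ₘ t) = ⊕-encodes-parallel (mspExpr-encodes s) (mspExpr-encodes t)
mspExpr-encodes (s ×ₘ t) =
  ⊛-encodes-series (mspExpr-encodes s) (mspExpr-encodes t) (msp-hasSink s) (msp-hasSource t)

proposition6p5 : (G : Digraph) → IsMSP G → dcw≤ G 7
proposition6p5 G (t , f , f-preserves-arcs) = size ⟦ t ⟧ₘ , mspExpr t , f , λ u v →
  trans (f-preserves-arcs u v) (sym (arcs≡ (mspExpr-encodes t) (Inverse.to f u) (Inverse.to f v)))
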